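{- Let $r\geq 2$ and let $p_1<p_2<\cdots<p_r$ be primes. If $p_1\geq\frac{r+2}{2}$, then $3\phi(p_1p_2\cdots p_r)\geq p_1p_2\cdots p_r$, with equality if and only if $(r,p_1,p_2)=(2,2,3)$.
   Context: $\phi$ is Euler's totient function. -}

module Defs where

open import Data.Nat using (ℕ; zero; suc)
open import Data.Nat.GCD using (gcd)
open import Data.List using (List; filter; length; upTo; map)
open import Data.Nat using (_≟_)
open import Relation.Nullary.Decidable using (Dec)

φ : ℕ → ℕ
φ n = length (filter (λ k → gcd k n ≟ 1) (map suc (upTo n)))

module Submission where

-- For distinct primes φ(p₁⋯p_r) = ∏ (pᵢ − 1), where φ(pm) = (p − 1) φ(m) for p ∤ m follows by
-- counting the k ≤ pm coprime to m. The claim is then ∏ pᵢ / (pᵢ − 1) ≤ 3. As pᵢ ≥ p₁ + i − 1 the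
-- product is at most the telescoping ∏ (p₁ + i − 1) / (p₁ + i − 2) = (p₁ + r − 1) / (p₁ − 1), which
-- is ≤ 3 exactly when r + 2 ≤ 2 p₁. The comparison at p₂ is strict unless p₂ = p₁ + 1, and
-- two consecutive primes are 2 and 3, after which r + 2 ≤ 4 gives r = 2.

open import Defs
open import Data.Nat using (ℕ; zero; suc; pred; _+_; _*_; _≤_; _<_; z≤n; s≤s; _≟_)
open import Data.Nat.Properties
open import Data.Nat.Divisibility using (_∣_; _∣?_; m∣m*n; ∣-trans; ∣1⇒≡1; ∣m∣n⇒∣m+n; ∣m+n∣m⇒∣n; ∣m⇒∣m*n; n∣m*n; ∣⇒≤; ∣-refl)
open import Data.Nat.Coprimality as Coprimality using (Coprime; coprime?; coprime-+; coprime-divisor; coprime⇒gcd≡1; gcd≡1⇒coprime)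
open import Data.Nat.GCD using (gcd)
open import Data.Nat.Primality using (Prime; euclidsLemma; prime⇒irreducible; prime⇒nonTrivial)
open import Data.Nat.Base using (nonTrivial⇒n>1; >-nonZero)
open import Data.Nat.ListAction using (product)
open import Data.List using (List; []; _∷_; length; filter; map; upTo; applyUpTo)
open import Data.List.Properties using (map-applyUpTo)
open import Data.List.Relation.Unary.All as All using (All; []; _∷_)
open import Data.List.Relation.Unary.AllPairs as AllPairs using (AllPairs; []; _∷_)
open import Data.List.Relation.Unary.Linked using (Linked; [-]; _∷_)
open import Data.List.Relation.Unary.Linked.Properties using (Linked⇒All; Linked⇒AllPairs)
open import Data.Product using (_×_; _,_; proj₁; proj₂)
open import Data.Empty using (⊥-elim)
open import Data.Sum using (_⊎_; inj₁; inj₂)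
open import Function using (_∘_)
open import Function.Bundles using (_⇔_; mk⇔; Equivalence)
open import Relation.Nullary using (Dec; yes; no; ¬_; contradiction)
open import Relation.Unary using (Decidable)
open import Relation.Binary.PropositionalEquality
open import Data.Nat.Tactic.RingSolver using (solve-∀)

𝟙 : ∀ {A : Set} → Dec A → ℕ
𝟙 (yes _) = 1
𝟙 (no _)  = 0

𝟙-cong : ∀ {A B : Set} → A ⇔ B → (a? : Dec A) (b? : Dec B) → 𝟙 a? ≡ 𝟙 b?
𝟙-cong A⇔B (yes a) (yes b) = refl
𝟙-cong A⇔B (yes a) (no ¬b) = contradiction (Equivalence.to A⇔B a) ¬b
𝟙-cong A⇔B (no ¬a) (yes b) = contradiction (Equivalence.from A⇔B b) ¬a
𝟙-cong A⇔B (no _)  (no _)  = refl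

sumRange : (ℕ → ℕ) → ℕ → ℕ → ℕ
sumRange c a zero    = 0
sumRange c a (suc n) = c a + sumRange c (suc a) n

sumRange-cong : ∀ {c d} → (∀ i → c i ≡ d i) → ∀ a n → sumRange c a n ≡ sumRange d a n
sumRange-cong c≗d a zero    = refl
sumRange-cong c≗d a (suc n) = cong₂ _+_ (c≗d a) (sumRange-cong c≗d (suc a) n)

sumRange-+ : ∀ c d a n → sumRange (λ i → c i + d i) a n ≡ sumRange c a n + sumRange d a n
sumRange-+ c d a zero    = refl
sumRange-+ c d a (suc n) = begin
  (c a + d a) + sumRange (λ i → c i + d i) (suc a) n           ≡⟨ cong (c a + d a +_) (sumRange-+ c d (suc a) n) ⟩
  (c a + d a) + (sumRange c (suc a) n + sumRange d (suc a) n)  ≡⟨ +-interchange (c a) (d a) _ _ ⟩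
  (c a + sumRange c (suc a) n) + (d a + sumRange d (suc a) n)  ∎
  where
  +-interchange : ∀ w x y z → (w + x) + (y + z) ≡ (w + y) + (x + z)
  +-interchange = solve-∀
  open ≡-Reasoning

sumRange-split : ∀ c a m n → sumRange c a (m + n) ≡ sumRange c a m + sumRange c (a + m) n
sumRange-split c a zero    n = cong (λ b → sumRange c b n) (sym (+-identityʳ a))
sumRange-split c a (suc m) n = begin
  c a + sumRange c (suc a) (m + n)                        ≡⟨ cong (c a +_) (sumRange-split c (suc a) m n) ⟩
  c a + (sumRange c (suc a) m + sumRange c (suc a + m) n) ≡⟨ sym (+-assoc (c a) _ _) ⟩
  sumRange c a (suc m) + sumRange c (suc a + m) n         ≡⟨ cong (λ b → sumRange c a (suc m) + sumRange c b n) (sym (+-suc a m)) ⟩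
  sumRange c a (suc m) + sumRange c (a + suc m) n         ∎
  where open ≡-Reasoning

sumRange-periodic : ∀ c m → (∀ k → c (k + m) ≡ c k) → ∀ a q → sumRange c a (q * m) ≡ q * sumRange c a m
sumRange-periodic c m periodic a zero    = refl
sumRange-periodic c m periodic a (suc q) = begin
  sumRange c a (m + q * m)                     ≡⟨ sumRange-split c a m (q * m) ⟩
  sumRange c a m + sumRange c (a + m) (q * m)  ≡⟨ cong (sumRange c a m +_) (shift a (q * m)) ⟩
  sumRange c a m + sumRange c a (q * m)        ≡⟨ cong (sumRange c a m +_) (sumRange-periodic c m periodic a q) ⟩
  sumRange c a m + q * sumRange c a m          ∎
  where
  shift : ∀ b n → sumRange c (b + m) n ≡ sumRange c b n
  shift b zero    = refl
  shift b (suc n) = cong₂ _+_ (periodic b) (shift (suc b) n)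
  open ≡-Reasoning

sumRange-zero : ∀ c a n → (∀ i → i < n → c (a + i) ≡ 0) → sumRange c a n ≡ 0
sumRange-zero c a zero    vanish = refl
sumRange-zero c a (suc n) vanish = cong₂ _+_
  (trans (cong c (sym (+-identityʳ a))) (vanish 0 (s≤s z≤n)))
  (sumRange-zero c (suc a) n (λ i i<n → trans (cong c (sym (+-suc a i))) (vanish (suc i) (s≤s i<n))))

length-filter-applyUpTo : ∀ {P : ℕ → Set} (P? : Decidable P) f a → (∀ i → f i ≡ a + i) →
  ∀ n → length (filter P? (applyUpTo f n)) ≡ sumRange (𝟙 ∘ P?) a n
length-filter-applyUpTo P? f a f≗a+ zero    = refl
length-filter-applyUpTo P? f a f≗a+ (suc n)
  rewrite trans (f≗a+ 0) (+-identityʳ a)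
  with P? a | length-filter-applyUpTo P? (f ∘ suc) (suc a) (λ i → trans (f≗a+ (suc i)) (+-suc a i)) n
... | yes _ | ih = cong suc ih
... | no _  | ih = ih

φ≡sumRange : ∀ m → φ m ≡ sumRange (λ k → 𝟙 (coprime? k m)) 1 m
φ≡sumRange m = begin
  length (filter (λ k → gcd k m ≟ 1) (map suc (upTo m)))  ≡⟨ cong (length ∘ filter _) (map-applyUpTo (λ i → i) suc m) ⟩
  length (filter (λ k → gcd k m ≟ 1) (applyUpTo suc m))   ≡⟨ length-filter-applyUpTo (λ k → gcd k m ≟ 1) suc 1 (λ i → refl) m ⟩
  sumRange (λ k → 𝟙 (gcd k m ≟ 1)) 1 m                     ≡⟨ sumRange-cong (λ k → 𝟙-cong gcd≡1⇔coprime (gcd k m ≟ 1) (coprime? k m)) 1 m ⟩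
  sumRange (λ k → 𝟙 (coprime? k m)) 1 m                    ∎
  where
  open ≡-Reasoning
  gcd≡1⇔coprime : ∀ {k} → gcd k m ≡ 1 ⇔ Coprime k m
  gcd≡1⇔coprime = mk⇔ gcd≡1⇒coprime coprime⇒gcd≡1

prime>1 : ∀ {p} → Prime p → 1 < p
prime>1 {p} pp = nonTrivial⇒n>1 p {{prime⇒nonTrivial pp}}

prime∤⇒coprime : ∀ {p k} → Prime p → ¬ p ∣ k → Coprime p k
prime∤⇒coprime pp p∤k (d∣p , d∣k) with prime⇒irreducible pp d∣p
... | inj₁ d≡1 = d≡1
... | inj₂ refl = contradiction d∣k p∤k

coprime-* : ∀ {a b c} → Coprime a c → Coprime b c → Coprime (a * b) c
coprime-* {a} a⊥c b⊥c {d} (d∣ab , d∣c) = b⊥c (coprime-divisor d⊥a d∣ab , d∣c)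
  where
  d⊥a : Coprime d a
  d⊥a (e∣d , e∣a) = a⊥c (e∣a , ∣-trans e∣d d∣c)

coprime-+ʳ⇔ : ∀ {k m} → Coprime (k + m) m ⇔ Coprime k m
coprime-+ʳ⇔ {k} {m} = mk⇔ to from
  where
  to : Coprime (k + m) m → Coprime k m
  to k+m⊥m (d∣k , d∣m) = k+m⊥m (∣m∣n⇒∣m+n d∣k d∣m , d∣m)
  from : Coprime k m → Coprime (k + m) m
  from k⊥m = subst (λ n → Coprime n m) (+-comm m k) (coprime-+ k⊥m)

coprime-*ʳ⇔ : ∀ {i p m} → Coprime p m → Coprime (i * p) m ⇔ Coprime i m
coprime-*ʳ⇔ {i} {p} {m} p⊥m = mk⇔ to from
  where
  to : Coprime (i * p) m → Coprime i m
  to ip⊥m (d∣i , d∣m) = ip⊥m (∣m⇒∣m*n p d∣i , d∣m)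
  from : Coprime i m → Coprime (i * p) m
  from i⊥m = coprime-* i⊥m p⊥m

coprime-prime*⇔ : ∀ {p k m} → Prime p → Coprime k (p * m) ⇔ (¬ p ∣ k × Coprime k m)
coprime-prime*⇔ {p} {k} {m} pp = mk⇔ to from
  where
  to : Coprime k (p * m) → ¬ p ∣ k × Coprime k m
  to k⊥pm = (λ p∣k → <⇒≢ (prime>1 pp) (sym (k⊥pm (p∣k , m∣m*n m))))
          , (λ (d∣k , d∣m) → k⊥pm (d∣k , ∣-trans d∣m (n∣m*n p)))
  from : ¬ p ∣ k × Coprime k m → Coprime k (p * m)
  from (p∤k , k⊥m) = Coprimality.sym (coprime-* (prime∤⇒coprime pp p∤k) (Coprimality.sym k⊥m))

module _ (d : ℕ) where
  private
    p : ℕ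
    p = suc d
    open ≡-Reasoning

  -- Within the block jp+1, …, jp+p only the last entry (j+1)p is a multiple of p.
  sumRange-multiples-block : ∀ (g : ℕ → ℕ) j →
    sumRange (λ k → 𝟙 (p ∣? k) * g k) (suc (j * p)) p ≡ g (suc j * p)
  sumRange-multiples-block g j = begin
    sumRange c (suc (j * p)) p                                     ≡⟨ cong (sumRange c _) (+-comm 1 d) ⟩
    sumRange c (suc (j * p)) (d + 1)                               ≡⟨ sumRange-split c _ d 1 ⟩
    sumRange c (suc (j * p)) d + sumRange c (suc (j * p) + d) 1    ≡⟨ cong₂ _+_ (sumRange-zero c _ d non-multiple) (cong (λ a → sumRange c a 1) last) ⟩
    c (suc j * p) + 0                                              ≡⟨ +-identityʳ _ ⟩
    c (suc j * p)                                                  ≡⟨ multiple ⟩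
    g (suc j * p)                                                  ∎
    where
    c : ℕ → ℕ
    c k = 𝟙 (p ∣? k) * g k
    last : suc (j * p) + d ≡ suc j * p
    last = cong suc (+-comm (j * p) d)
    multiple : c (suc j * p) ≡ g (suc j * p)
    multiple with p ∣? suc j * p
    ... | yes _ = +-identityʳ _
    ... | no p∤ = contradiction (n∣m*n (suc j)) p∤
    non-multiple : ∀ i → i < d → c (suc (j * p) + i) ≡ 0
    non-multiple i i<d with p ∣? suc (j * p) + i
    ... | no _  = refl
    ... | yes p∣ = contradiction (∣⇒≤ p∣1+i) (<⇒≱ (s≤s i<d))
      where
      p∣1+i : p ∣ suc i
      p∣1+i = ∣m+n∣m⇒∣n (subst (p ∣_) (sym (+-suc (j * p) i)) p∣) (n∣m*n j)

  sumRange-multiples : ∀ (g : ℕ → ℕ) n j →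
    sumRange (λ k → 𝟙 (p ∣? k) * g k) (suc (j * p)) (n * p) ≡ sumRange (λ i → g (i * p)) (suc j) n
  sumRange-multiples g zero    j = refl
  sumRange-multiples g (suc n) j = begin
    sumRange c (suc (j * p)) (p + n * p)                         ≡⟨ sumRange-split c _ p (n * p) ⟩
    sumRange c (suc (j * p)) p + sumRange c (suc (j * p) + p) (n * p)
      ≡⟨ cong₂ _+_ (sumRange-multiples-block g j) (cong (λ a → sumRange c a (n * p)) (cong suc (+-comm (j * p) p))) ⟩
    g (suc j * p) + sumRange c (suc (suc j * p)) (n * p)         ≡⟨ cong (g (suc j * p) +_) (sumRange-multiples g n (suc j)) ⟩
    g (suc j * p) + sumRange (λ i → g (i * p)) (suc (suc j)) n   ∎
    where
    c : ℕ → ℕ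
    c k = 𝟙 (p ∣? k) * g k

𝟙-coprime-split : ∀ {p} → Prime p → ∀ m k →
  𝟙 (coprime? k m) ≡ 𝟙 (coprime? k (p * m)) + 𝟙 (p ∣? k) * 𝟙 (coprime? k m)
𝟙-coprime-split {p} pp m k with coprime? k m | p ∣? k | coprime? k (p * m)
... | yes _   | yes p∣k | yes k⊥pm  = contradiction p∣k (proj₁ (Equivalence.to (coprime-prime*⇔ pp) k⊥pm))
... | yes _   | yes _   | no _      = refl
... | yes _   | no _    | yes _     = refl
... | yes k⊥m | no p∤k  | no ¬k⊥pm  = ⊥-elim (¬k⊥pm (Equivalence.from (coprime-prime*⇔ pp) (p∤k , k⊥m)))
... | no ¬k⊥m | _       | yes k⊥pm  = ⊥-elim (¬k⊥m (proj₂ (Equivalence.to (coprime-prime*⇔ pp) k⊥pm)))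
... | no _    | p∣?k    | no _      = sym (*-zeroʳ (𝟙 p∣?k))

-- Counting 1 ≤ k ≤ pm coprime to m in two ways: p φ(m) by periodicity, and
-- φ(pm) plus the multiples k = ip with i coprime to m.
φ-*-prime : ∀ {p m} → Prime p → ¬ p ∣ m → φ (p * m) ≡ pred p * φ m
φ-*-prime {zero}  pp p∤m = contradiction (prime>1 pp) λ ()
φ-*-prime {suc d} {m} pp p∤m = +-cancelʳ-≡ (φ m) _ _ (trans counted-twice (+-comm (φ m) (d * φ m)))
  where
  open ≡-Reasoning
  p : ℕ
  p = suc d
  c : ℕ → ℕ
  c k = 𝟙 (coprime? k m)
  counted-twice : φ (p * m) + φ m ≡ p * φ m
  counted-twice = sym (begin
    p * φ m                                                  ≡⟨ cong (p *_) (φ≡sumRange m) ⟩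
    p * sumRange c 1 m                                       ≡⟨ sumRange-periodic c m (λ k → 𝟙-cong coprime-+ʳ⇔ _ _) 1 p ⟨
    sumRange c 1 (p * m)                                     ≡⟨ sumRange-cong (𝟙-coprime-split pp m) 1 (p * m) ⟩
    sumRange (λ k → 𝟙 (coprime? k (p * m)) + 𝟙 (p ∣? k) * c k) 1 (p * m)
      ≡⟨ sumRange-+ _ _ 1 (p * m) ⟩
    sumRange (λ k → 𝟙 (coprime? k (p * m))) 1 (p * m) + sumRange (λ k → 𝟙 (p ∣? k) * c k) 1 (p * m)
      ≡⟨ cong₂ _+_ (φ≡sumRange (p * m)) (cong (sumRange _ 1) (*-comm m p)) ⟨
    φ (p * m) + sumRange (λ k → 𝟙 (p ∣? k) * c k) 1 (m * p)  ≡⟨ cong (φ (p * m) +_) (sumRange-multiples d c m 0) ⟩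
    φ (p * m) + sumRange (λ i → c (i * p)) 1 m               ≡⟨ cong (φ (p * m) +_) (sumRange-cong (λ i → 𝟙-cong (coprime-*ʳ⇔ (prime∤⇒coprime pp p∤m)) _ _) 1 m) ⟩
    φ (p * m) + sumRange c 1 m                               ≡⟨ cong (φ (p * m) +_) (φ≡sumRange m) ⟨
    φ (p * m) + φ m                                          ∎)

prime∤product : ∀ {p qs} → Prime p → All Prime qs → All (p ≢_) qs → ¬ p ∣ product qs
prime∤product pp []          []            p∣1 = <⇒≢ (prime>1 pp) (sym (∣1⇒≡1 p∣1))
prime∤product pp (qq ∷ qqs) (p≢q ∷ p≢qs) p∣qQ with euclidsLemma _ _ pp p∣qQ
... | inj₂ p∣Q = prime∤product pp qqs p≢qs p∣Q
... | inj₁ p∣q with prime⇒irreducible qq p∣q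
...   | inj₁ p≡1 = <⇒≢ (prime>1 pp) (sym p≡1)
...   | inj₂ p≡q = p≢q p≡q

φ-product : ∀ {ps} → All Prime ps → AllPairs _≢_ ps → φ (product ps) ≡ product (map pred ps)
φ-product []         []                 = refl
φ-product {p ∷ _} (pp ∷ pps) (p≢ps ∷ distinct) =
  trans (φ-*-prime pp (prime∤product pp pps p≢ps)) (cong (pred p *_) (φ-product pps distinct))

private
  expandˡ : ∀ b c k → b * (suc c + k) ≡ b * c + b * suc k
  expandˡ = solve-∀
  expandʳ : ∀ b c k → (b + suc k) * c ≡ b * c + c * suc k
  expandʳ = solve-∀

telescope-step : ∀ b c k → b ≤ c → b * (suc c + k) ≤ (b + suc k) * c
telescope-step b c k b≤c = begin
  b * (suc c + k)      ≡⟨ expandˡ b c k ⟩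
  b * c + b * suc k    ≤⟨ +-monoʳ-≤ (b * c) (*-monoˡ-≤ (suc k) b≤c) ⟩
  b * c + c * suc k    ≡⟨ expandʳ b c k ⟨
  (b + suc k) * c      ∎
  where open ≤-Reasoning

telescope-step-< : ∀ b c k → b < c → b * (suc c + k) < (b + suc k) * c
telescope-step-< b c k b<c = begin-strict
  b * (suc c + k)      ≡⟨ expandˡ b c k ⟩
  b * c + b * suc k    <⟨ +-monoʳ-< (b * c) (*-monoˡ-< (suc k) b<c) ⟩
  b * c + c * suc k    ≡⟨ expandʳ b c k ⟨
  (b + suc k) * c      ∎
  where open ≤-Reasoning

telescope : ∀ {b qs} → Linked _<_ (b ∷ qs) → b * product qs ≤ (b + length qs) * product (map pred qs)
telescope {b} {[]}         [-]             = ≤-reflexive (cong (_* 1) (sym (+-identityʳ b)))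
telescope {b} {suc c ∷ qs} (b<q ∷ sorted) = begin
  b * (suc c * product qs)                   ≤⟨ *-monoʳ-≤ b (telescope sorted) ⟩
  b * ((suc c + length qs) * Q)              ≡⟨ *-assoc b _ Q ⟨
  b * (suc c + length qs) * Q                ≤⟨ *-monoˡ-≤ Q (telescope-step b c (length qs) (≤-pred b<q)) ⟩
  (b + suc (length qs)) * c * Q              ≡⟨ *-assoc (b + suc (length qs)) c Q ⟩
  (b + suc (length qs)) * (c * Q)            ∎
  where
  open ≤-Reasoning
  Q = product (map pred qs)

product-pred-pos : ∀ {ns} → All (1 <_) ns → 0 < product (map pred ns)
product-pred-pos []                      = s≤s z≤n
product-pred-pos (s≤s (s≤s {n = n} _) ∷ 1<ns) = *-mono-≤ {1} {suc n} (s≤s z≤n) (product-pred-pos 1<ns)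

telescope-< : ∀ {b q qs} → suc b < q → Linked _<_ (q ∷ qs) →
  b * product (q ∷ qs) < (b + length (q ∷ qs)) * product (map pred (q ∷ qs))
telescope-< {b} {suc c} {qs} 1+b<q sorted = begin-strict
  b * (suc c * product qs)                   ≤⟨ *-monoʳ-≤ b (telescope sorted) ⟩
  b * ((suc c + length qs) * Q)              ≡⟨ *-assoc b _ Q ⟨
  b * (suc c + length qs) * Q                <⟨ *-monoˡ-< Q {{>-nonZero Q>0}} (telescope-step-< b c (length qs) (≤-pred 1+b<q)) ⟩
  (b + suc (length qs)) * c * Q              ≡⟨ *-assoc (b + suc (length qs)) c Q ⟩
  (b + suc (length qs)) * (c * Q)            ∎
  where
  open ≤-Reasoning
  Q = product (map pred qs)
  Q>0 : 0 < Q
  Q>0 = product-pred-pos (All.tail (Linked⇒All <-trans (≤-trans (s≤s (s≤s z≤n)) 1+b<q) sorted))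

2∣n⊎2∣1+n : ∀ n → 2 ∣ n ⊎ 2 ∣ suc n
2∣n⊎2∣1+n zero    = inj₁ (n∣m*n 0)
2∣n⊎2∣1+n (suc n) with 2∣n⊎2∣1+n n
... | inj₁ 2∣n   = inj₂ (∣m∣n⇒∣m+n ∣-refl 2∣n)
... | inj₂ 2∣1+n = inj₁ 2∣1+n

prime-consecutive⇒≡2 : ∀ {p} → Prime p → Prime (suc p) → p ≡ 2
prime-consecutive⇒≡2 {p} pp p+1p with 2∣n⊎2∣1+n p
... | inj₁ 2∣p with prime⇒irreducible pp 2∣p
...   | inj₂ 2≡p = sym 2≡p
prime-consecutive⇒≡2 {p} pp p+1p | inj₂ 2∣1+p with prime⇒irreducible p+1p 2∣1+p
...   | inj₂ 2≡1+p = contradiction (subst Prime (sym (cong pred 2≡1+p)) pp) λ ()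

2+k+2≤2*p⇒p+suc[k]≤3*pred[p] : ∀ {p k} → (2 + k) + 2 ≤ 2 * p → p + suc k ≤ 3 * pred p
2+k+2≤2*p⇒p+suc[k]≤3*pred[p] {suc a} {k} hyp = begin
  suc a + suc k   ≡⟨ lhs a k ⟩
  a + (k + 2)     ≤⟨ +-monoʳ-≤ a (+-cancelʳ-≤ 2 (k + 2) (2 * a) (subst₂ _≤_ (shift k) (rhs a) hyp)) ⟩
  a + 2 * a       ≡⟨ 3* a ⟩
  3 * a           ∎
  where
  open ≤-Reasoning
  lhs : ∀ a k → suc a + suc k ≡ a + (k + 2)
  lhs = solve-∀
  shift : ∀ k → (2 + k) + 2 ≡ (k + 2) + 2
  shift = solve-∀
  rhs : ∀ a → 2 * suc a ≡ 2 * a + 2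
  rhs = solve-∀
  3* : ∀ a → a + 2 * a ≡ 3 * a
  3* = solve-∀

3*φ[2*3]≡2*3 : ∀ rest → 2 + length rest ≡ 2 → 3 * φ (product (2 ∷ 3 ∷ rest)) ≡ product (2 ∷ 3 ∷ rest)
3*φ[2*3]≡2*3 [] _ = refl

lemma2p3 : (p₁ p₂ : ℕ) (rest : List ℕ) →
    All Prime (p₁ ∷ p₂ ∷ rest) →
    Linked _<_ (p₁ ∷ p₂ ∷ rest) →
    (2 + length rest) + 2 ≤ 2 * p₁ →
    (product (p₁ ∷ p₂ ∷ rest) ≤ 3 * φ (product (p₁ ∷ p₂ ∷ rest)))
    × ((3 * φ (product (p₁ ∷ p₂ ∷ rest)) ≡ product (p₁ ∷ p₂ ∷ rest))
    ⇔ ((2 + length rest ≡ 2) × (p₁ ≡ 2) × (p₂ ≡ 3)))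
lemma2p3 p₁ p₂ rest primes@(pp₁ ∷ pp₂ ∷ _) sorted@(p₁<p₂ ∷ sorted₂) hyp =
  ≤-trans (telescope sorted) ≤3φN , mk⇔ equality-case (λ { (r≡2 , refl , refl) → 3*φ[2*3]≡2*3 rest r≡2 })
  where
  N = product (p₁ ∷ p₂ ∷ rest)
  Q = product (map pred (p₂ ∷ rest))
  ≤3φN : (p₁ + length (p₂ ∷ rest)) * Q ≤ 3 * φ N
  ≤3φN = begin
    (p₁ + length (p₂ ∷ rest)) * Q  ≤⟨ *-monoˡ-≤ Q (2+k+2≤2*p⇒p+suc[k]≤3*pred[p] {p₁} hyp) ⟩
    3 * pred p₁ * Q                ≡⟨ *-assoc 3 (pred p₁) Q ⟩
    3 * (pred p₁ * Q)              ≡⟨ cong (3 *_) (φ-product primes (AllPairs.map <⇒≢ (Linked⇒AllPairs <-trans sorted))) ⟨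
    3 * φ N                        ∎
    where open ≤-Reasoning
  equality-case : 3 * φ N ≡ N → (2 + length rest ≡ 2) × (p₁ ≡ 2) × (p₂ ≡ 3)
  equality-case 3φN≡N with m≤n⇒m<n∨m≡n p₁<p₂
  ... | inj₁ 1+p₁<p₂ = contradiction (sym 3φN≡N) (<⇒≢ (<-≤-trans (telescope-< 1+p₁<p₂ sorted₂) ≤3φN))
  ... | inj₂ refl with refl ← prime-consecutive⇒≡2 pp₁ pp₂ =
    cong (2 +_) (n≤0⇒n≡0 (+-cancelʳ-≤ 2 (length rest) 0 (≤-pred (≤-pred hyp)))) , refl , refl
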